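{- Let $T[0..n)$ be a text and $P[0..m)$ a pattern, and let $\mathsf{eMS}$ be the extended matching statistics of $P$ with respect to $T$. For $i\in[0..m)$ let $w_i=P[i..i+\mathsf{eMS}[i].\mathsf{len})$, and let $\mathcal{L}\subseteq[0..m)$ be the set of positions $i$ such that $w_i$ is a maximal match and occurs exactly once in $T$. Then for all $0\le i<m$, $w_i$ is a maximal unique match (MUM) if and only if $i\in\mathcal{L}$ and for all $i'\in\mathcal{L}\setminus\{i\}$, either $\mathsf{eMS}[i].\mathsf{pos}<\mathsf{eMS}[i'].\mathsf{pos}$ or $\mathsf{eMS}[i].\mathsf{len}+\mathsf{eMS}[i].\mathsf{pos} > \mathsf{eMS}[i'].\mathsf{len}+\mathsf{eMS}[i'].\mathsf{pos}$.
   Context: Strings are indexed from $0$; $S[i..j)=S[i]S[i+1]\cdots S[j-1]$ (empty if $i\ge j$). The text $T$ ends with a terminator $\$$ occurring nowhere else, lexicographically smallest. A match is a pair $(i,\ell)$ such that the factor $P[i..i+\ell)$ occurs in $T$; it is maximal if either $i=0$ or $P[i-1..i+\ell)$ does not occur in $T$, and either $i=m-\ell$ or $P[i..i+\ell+1)$ does not occur in $T$. A maximal unique match (MUM) is a maximal match whose factor occurs exactly once in $T$ and exactly once in $P$. The extended matching statistics $\mathsf{eMS}[0..m)$ is an array of triples $(\mathsf{pos},\mathsf{len},\mathsf{twice})$ such that for each $i$: $P[i..i+\mathsf{eMS}[i].\mathsf{len}) = T[\mathsf{eMS}[i].\mathsf{pos}..\mathsf{eMS}[i].\mathsf{pos}+\mathsf{eMS}[i].\mathsf{len})$;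 either $i=m-\mathsf{eMS}[i].\mathsf{len}$ or $P[i..i+\mathsf{eMS}[i].\mathsf{len}+1)$ does not occur in $T$; and $\mathsf{eMS}[i].\mathsf{twice}$ is the largest $\ell$ for which there exists a position $p\neq \mathsf{eMS}[i].\mathsf{pos}$ with $P[i..i+\ell)=T[p..p+\ell)$. -}

module Defs where

open import Data.Nat using (ℕ; zero; suc; _+_; _∸_; _≤_; _<_)
open import Data.List using (List; []; _∷_; length; take; drop; _++_; [_])
open import Data.List.Membership.Propositional using (_∈_)
open import Data.Product using (Σ; ∃; _×_; _,_)
open import Data.Sum using (_⊎_)
open import Relation.Nullary using (¬_)
open import Relation.Binary.PropositionalEquality using (_≡_; _≢_)

-- Strings are lists, indexed from 0.
-- factor S i ℓ = S[i..i+ℓ)  (only meaningful when i + ℓ ≤ length S)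
factor : {A : Set} → List A → ℕ → ℕ → List A
factor S i ℓ = take ℓ (drop i S)

OccursAt : {A : Set} → List A → List A → ℕ → Set
OccursAt S w p = (p + length w ≤ length S) × (factor S p (length w) ≡ w)

Occurs : {A : Set} → List A → List A → Set
Occurs S w = ∃ λ p → OccursAt S w p

OccursOnce : {A : Set} → List A → List A → Set
OccursOnce S w = ∃ λ p → OccursAt S w p × (∀ q → OccursAt S w q → q ≡ p)

EndsWithUniqueTerminator : {A : Set} → List A → A → Set
EndsWithUniqueTerminator T d = ∃ λ T' → (T ≡ T' ++ [ d ]) × ¬ (d ∈ T')

IsMatch : {A : Set} → List A → List A → ℕ → ℕ → Set
IsMatch T P i ℓ = (i + ℓ ≤ length P) × Occurs T (factor P i ℓ)

IsMaximalMatch : {A : Set} → List A → List A → ℕ → ℕ → Set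
IsMaximalMatch T P i ℓ =
  IsMatch T P i ℓ
  × (i ≡ 0 ⊎ ¬ Occurs T (factor P (i ∸ 1) (suc ℓ)))
  × (i ≡ length P ∸ ℓ ⊎ ¬ Occurs T (factor P i (suc ℓ)))

IsMUM : {A : Set} → List A → List A → ℕ → ℕ → Set
IsMUM T P i ℓ =
  IsMaximalMatch T P i ℓ × OccursOnce T (factor P i ℓ) × OccursOnce P (factor P i ℓ)

record Triple : Set where
  constructor triple
  field
    pos   : ℕ
    len   : ℕ
    twice : ℕ
open Triple public

FactorsEqual : {A : Set} → List A → List A → ℕ → ℕ → ℕ → Set
FactorsEqual T P i p ℓ =
  (i + ℓ ≤ length P) × (p + ℓ ≤ length T) × (factor P i ℓ ≡ factor T p ℓ)

IsEMS : {A : Set} → List A → List A → (ℕ → Triple) → Set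
IsEMS T P e = ∀ i → i < length P →
  FactorsEqual T P i (pos (e i)) (len (e i))
  × (i ≡ length P ∸ len (e i) ⊎ ¬ Occurs T (factor P i (suc (len (e i)))))
  × (∃ λ p → p ≢ pos (e i) × FactorsEqual T P i p (twice (e i)))
  × (∀ ℓ p → p ≢ pos (e i) → FactorsEqual T P i p ℓ → ℓ ≤ twice (e i))

InL : {A : Set} → List A → List A → (ℕ → Triple) → ℕ → Set
InL T P e i =
  (i < length P)
  × IsMaximalMatch T P i (len (e i))
  × OccursOnce T (factor P i (len (e i)))

-- If w_i is a MUM whose occurrence in T lies inside the occurrence of some w_{i′}, then w_i also
-- occurs in P inside w_{i′}.  By uniqueness in P that copy is w_i itself, so it starts strictly
-- after i′, and then the character before it extends w_i to a factor of T, contradicting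
-- left-maximality.  Conversely, if w_i occurs in P again at j ≠ i, take the leftmost j′ ≤ j whose
-- match still reaches j + |w_i|.  That match is left-maximal (a left extension would let the match
-- at j′ − 1 reach just as far) and contains w_i, which occurs once in T; so it lies in 𝓛, and its
-- occurrence in T contains that of w_i.
module Submission where

open import Defs
open import Data.Nat using (ℕ; zero; suc; _+_; _∸_; _≤_; _<_; z≤n; z<s; _≤?_; _<?_; _≟_; _⊓_)
open import Data.Nat.Properties
open import Data.List using (List; []; [_]; take; drop; length)
open import Data.List.Properties using (length-take; length-drop; take-take; take-drop; drop-drop; length-++)
open import Data.Sum using (_⊎_; inj₁; inj₂)
open import Data.Product using (∃; _×_; _,_; proj₁; proj₂)
open import Data.Empty using (⊥; ⊥-elim)
open import Function.Bundles using (_⇔_; mk⇔)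
open import Relation.Nullary using (¬_; yes; no; contradiction)
open import Relation.Unary using (Decidable)
open import Relation.Binary.PropositionalEquality using (_≡_; _≢_; refl; sym; trans; cong; subst; subst₂; module ≡-Reasoning)

offset-fits : ∀ {q p ℓ L} → q ≤ p → p + ℓ ≤ q + L → p ∸ q + ℓ ≤ L
offset-fits {q} {p} {ℓ} {L} q≤p p+ℓ≤q+L = +-cancelˡ-≤ q (p ∸ q + ℓ) L (begin
  q + (p ∸ q + ℓ)  ≡⟨ +-assoc q (p ∸ q) ℓ ⟨
  q + (p ∸ q) + ℓ  ≡⟨ cong (_+ ℓ) (m+[n∸m]≡n q≤p) ⟩
  p + ℓ            ≤⟨ p+ℓ≤q+L ⟩
  q + L            ∎)
  where open ≤-Reasoning

window-within : ∀ {p k q ℓ L} → p + k ≡ q → k + ℓ ≤ L → p ≤ q × ℓ + q ≤ L + p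
window-within {p} {k} {q} {ℓ} {L} refl k+ℓ≤L = m≤m+n p k , (begin
  ℓ + (p + k)  ≡⟨ +-comm ℓ (p + k) ⟩
  p + k + ℓ    ≡⟨ +-assoc p k ℓ ⟩
  p + (k + ℓ)  ≤⟨ +-monoʳ-≤ p k+ℓ≤L ⟩
  p + L        ≡⟨ +-comm p L ⟩
  L + p        ∎)
  where open ≤-Reasoning

run-start : ∀ {Q : ℕ → Set} → Decidable Q → ∀ {j} → Q j →
            ∃ λ j′ → j′ ≤ j × Q j′ × (j′ ≡ 0 ⊎ ¬ Q (j′ ∸ 1))
run-start Q? {zero} q = 0 , z≤n , q , inj₁ refl
run-start Q? {suc j} q with Q? j
... | no ¬q = suc j , ≤-refl , q , inj₂ ¬q
... | yes q′ with run-start Q? q′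
...   | j′ , j′≤j , qj′ , start = j′ , m≤n⇒m≤1+n j′≤j , qj′ , start

module _ {A : Set} where

  length-factor : ∀ (S : List A) {i ℓ} → i + ℓ ≤ length S → length (factor S i ℓ) ≡ ℓ
  length-factor S {i} {ℓ} i+ℓ≤∣S∣ = begin
    length (take ℓ (drop i S))  ≡⟨ length-take ℓ (drop i S) ⟩
    ℓ ⊓ length (drop i S)       ≡⟨ cong (ℓ ⊓_) (length-drop i S) ⟩
    ℓ ⊓ (length S ∸ i)          ≡⟨ m≤n⇒m⊓n≡m (m+n≤o⇒m≤o∸n ℓ (subst (_≤ length S) (+-comm i ℓ) i+ℓ≤∣S∣)) ⟩
    ℓ                           ∎
    where open ≡-Reasoning

  factor-factor : ∀ (S : List A) i {k ℓ L} → k + ℓ ≤ L → factor (factor S i L) k ℓ ≡ factor S (i + k) ℓ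
  factor-factor S i {k} {ℓ} {L} k+ℓ≤L = begin
    take ℓ (drop k (take L (drop i S)))        ≡⟨ take-drop ℓ k _ ⟩
    drop k (take (k + ℓ) (take L (drop i S)))  ≡⟨ cong (drop k) (take-take (k + ℓ) L _) ⟩
    drop k (take ((k + ℓ) ⊓ L) (drop i S))     ≡⟨ cong (λ n → drop k (take n _)) (m≤n⇒m⊓n≡m k+ℓ≤L) ⟩
    drop k (take (k + ℓ) (drop i S))           ≡⟨ take-drop ℓ k _ ⟨
    take ℓ (drop k (drop i S))                 ≡⟨ cong (take ℓ) (drop-drop i k S) ⟩
    take ℓ (drop (i + k) S)                    ∎
    where open ≡-Reasoning

  OccursOnce-unique : ∀ {S w : List A} {p q} → OccursOnce S w → OccursAt S w p → OccursAt S w q → p ≡ q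
  OccursOnce-unique (_ , _ , unique) occ occ′ = trans (unique _ occ) (sym (unique _ occ′))

  ¬OccursOnce-[] : ∀ {S : List A} → 0 < length S → ¬ OccursOnce S []
  ¬OccursOnce-[] {S} 0<∣S∣ once =
    contradiction (OccursOnce-unique {S} once (z≤n , refl) (0<∣S∣ , refl)) λ ()

  -- The terminator is only needed to make T nonempty, which rules out the empty word as a unique match.
  EndsWithUniqueTerminator⇒nonempty : ∀ {T : List A} {d} → EndsWithUniqueTerminator T d → 0 < length T
  EndsWithUniqueTerminator⇒nonempty {d = d} (T′ , refl , _) =
    subst (0 <_) (sym (length-++ T′ {[ d ]})) (m≤n+m 1 (length T′))

  FactorsEqual-refl : ∀ {P : List A} {i ℓ} → i + ℓ ≤ length P → FactorsEqual P P i i ℓ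
  FactorsEqual-refl i+ℓ≤∣P∣ = i+ℓ≤∣P∣ , i+ℓ≤∣P∣ , refl

  FactorsEqual-sym : ∀ {T P : List A} {i p ℓ} → FactorsEqual T P i p ℓ → FactorsEqual P T p i ℓ
  FactorsEqual-sym (bound , bound′ , eq) = bound′ , bound , sym eq

  FactorsEqual-trans : ∀ {R Q P : List A} {i j p ℓ} →
                       FactorsEqual Q P i j ℓ → FactorsEqual R Q j p ℓ → FactorsEqual R P i p ℓ
  FactorsEqual-trans (bound , _ , eq) (_ , bound′ , eq′) = bound , bound′ , trans eq eq′

  FactorsEqual-window : ∀ {T P : List A} {i p} k {ℓ L} → k + ℓ ≤ L →
                        FactorsEqual T P i p L → FactorsEqual T P (i + k) (p + k) ℓ
  FactorsEqual-window {T} {P} {i} {p} k {ℓ} {L} fits (bound , bound′ , eq) =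
    inner bound , inner bound′ ,
    trans (sym (factor-factor P i fits)) (trans (cong (λ S → factor S k ℓ) eq) (factor-factor T p fits))
    where
    inner : ∀ {x n} → x + L ≤ n → x + k + ℓ ≤ n
    inner {x} x+L≤n = ≤-trans (≤-reflexive (+-assoc x k ℓ)) (≤-trans (+-monoʳ-≤ x fits) x+L≤n)

  FactorsEqual-prefix : ∀ {T P : List A} {i p ℓ L} → ℓ ≤ L → FactorsEqual T P i p L → FactorsEqual T P i p ℓ
  FactorsEqual-prefix {T} {P} {i} {p} {ℓ} ℓ≤L eq =
    subst₂ (λ x y → FactorsEqual T P x y ℓ) (+-identityʳ i) (+-identityʳ p) (FactorsEqual-window 0 ℓ≤L eq)

  FactorsEqual⇒OccursAt : ∀ {T P : List A} {i p ℓ} → FactorsEqual T P i p ℓ → OccursAt T (factor P i ℓ) p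
  FactorsEqual⇒OccursAt {T} {P} {i} {p} {ℓ} (bound , bound′ , eq) =
    subst (λ n → p + n ≤ length T × factor T p n ≡ factor P i ℓ) (sym (length-factor P bound)) (bound′ , sym eq)

  OccursAt⇒FactorsEqual : ∀ {T P : List A} {i p ℓ} → i + ℓ ≤ length P →
                          OccursAt T (factor P i ℓ) p → FactorsEqual T P i p ℓ
  OccursAt⇒FactorsEqual {T} {P} {i} {p} {ℓ} bound occ
    with subst (λ n → p + n ≤ length T × factor T p n ≡ factor P i ℓ) (length-factor P bound) occ
  ... | bound′ , eq = bound , bound′ , sym eq

  OccursOnce⇒nonempty : ∀ {T P : List A} {i ℓ} → 0 < length T → OccursOnce T (factor P i ℓ) → 0 < ℓ
  OccursOnce⇒nonempty {T} {ℓ = zero} 0<∣T∣ once = contradiction once (¬OccursOnce-[] {T} 0<∣T∣)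
  OccursOnce⇒nonempty {ℓ = suc ℓ} _ _ = z<s

  OccursOnce-window-position : ∀ {T P : List A} {x p q} k {ℓ L} → k + ℓ ≤ L →
                               FactorsEqual T P x p L → OccursOnce T (factor P (x + k) ℓ) →
                               FactorsEqual T P (x + k) q ℓ → p + k ≡ q
  OccursOnce-window-position k fits eq once eq′ =
    OccursOnce-unique once (FactorsEqual⇒OccursAt (FactorsEqual-window k fits eq)) (FactorsEqual⇒OccursAt eq′)

  OccursOnce-superfactor : ∀ {T P : List A} {x p} k {ℓ L} → k + ℓ ≤ L →
                           FactorsEqual T P x p L → OccursOnce T (factor P (x + k) ℓ) →
                           OccursOnce T (factor P x L)
  OccursOnce-superfactor {T} {P} {x} {p} k {ℓ} fits eq once =
    p , FactorsEqual⇒OccursAt eq , λ q occ →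
      +-cancelʳ-≡ k q p (trans (OccursOnce-window-position k fits (OccursAt⇒FactorsEqual (proj₁ eq) occ) once inner)
                               (sym (OccursOnce-window-position k fits eq once inner)))
    where
    inner : FactorsEqual T P (x + k) (p + k) ℓ
    inner = FactorsEqual-window k fits eq

module MatchingStatistics {A : Set} {T P : List A} {e : ℕ → Triple} (ems : IsEMS T P e) where

  match : ∀ {x} → x < length P → FactorsEqual T P x (pos (e x)) (len (e x))
  match {x} x<m = proj₁ (ems x x<m)

  right-maximal : ∀ {x} → x < length P → x ≡ length P ∸ len (e x) ⊎ ¬ Occurs T (factor P x (suc (len (e x))))
  right-maximal {x} x<m = proj₁ (proj₂ (ems x x<m))

  len-maximal : ∀ {x p ℓ} → x < length P → FactorsEqual T P x p ℓ → ℓ ≤ len (e x)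
  len-maximal {x} {p} {ℓ} x<m eq with ℓ ≤? len (e x)
  ... | yes ℓ≤len = ℓ≤len
  ... | no ℓ≰len with right-maximal x<m | FactorsEqual-prefix (≰⇒> ℓ≰len) eq
  ...   | inj₂ ¬longer | longer = contradiction (p , FactorsEqual⇒OccursAt longer) ¬longer
  ...   | inj₁ x≡m∸len | (x+len<m , _) =
    ⊥-elim (<-irrefl x≡m∸len (m+n≤o⇒m≤o∸n (suc x) (subst (_≤ length P) (+-suc x (len (e x))) x+len<m)))

  Reaches : ℕ → ℕ → Set
  Reaches n x = n ≤ x + len (e x)

  left-extension-reaches : ∀ {x} → suc x < length P → Occurs T (factor P x (suc (len (e (suc x))))) →
                           Reaches (suc x + len (e (suc x))) x
  left-extension-reaches {x} sx<m (p , occ) =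
    subst (_≤ x + len (e x)) (+-suc x ℓ) (+-monoʳ-≤ x (len-maximal (<-trans (n<1+n x) sx<m) extended))
    where
    ℓ : ℕ
    ℓ = len (e (suc x))
    extended : FactorsEqual T P x p (suc ℓ)
    extended = OccursAt⇒FactorsEqual (subst (_≤ length P) (sym (+-suc x ℓ)) (proj₁ (match sx<m))) occ

  leftmost-reaching⇒left-maximal : ∀ {n} x → x < length P → Reaches n x → (x ≡ 0 ⊎ ¬ Reaches n (x ∸ 1)) →
                                   x ≡ 0 ⊎ ¬ Occurs T (factor P (x ∸ 1) (suc (len (e x))))
  leftmost-reaching⇒left-maximal zero _ _ _ = inj₁ refl
  leftmost-reaching⇒left-maximal (suc x) sx<m reach (inj₂ ¬reach) =
    inj₂ λ occ → ¬reach (≤-trans reach (left-extension-reaches sx<m occ))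

  textEnd : ℕ → ℕ
  textEnd x = len (e x) + pos (e x)

  Nested : ℕ → ℕ → Set
  Nested x y = pos (e y) ≤ pos (e x) × textEnd x ≤ textEnd y

  ¬Nested⇒separated : ∀ {x y} → ¬ Nested x y → pos (e x) < pos (e y) ⊎ textEnd y < textEnd x
  ¬Nested⇒separated {x} {y} ¬nested with pos (e x) <? pos (e y) | textEnd y <? textEnd x
  ... | yes before | _         = inj₁ before
  ... | no _       | yes after = inj₂ after
  ... | no ¬before | no ¬after = ⊥-elim (¬nested (≮⇒≥ ¬before , ≮⇒≥ ¬after))

  separated⇒¬Nested : ∀ {x y} → pos (e x) < pos (e y) ⊎ textEnd y < textEnd x → ¬ Nested x y
  separated⇒¬Nested (inj₁ before) (starts , _) = <⇒≱ before starts
  separated⇒¬Nested (inj₂ after)  (_ , ends)   = <⇒≱ after ends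

  MUM⇒¬Nested : ∀ {i i′} → i < length P → i′ < length P → i′ ≢ i →
                IsMUM T P i (len (e i)) → ¬ Nested i i′
  MUM⇒¬Nested {i} {i′} i<m i′<m i′≢i ((_ , left-maximal , _) , _ , onceP) (starts , ends) =
    copy-inside-i′ (pos (e i) ∸ pos (e i′)) (m+[n∸m]≡n starts)
                   (offset-fits starts (subst₂ _≤_ (+-comm (len (e i)) _) (+-comm (len (e i′)) _) ends))
    where
    ℓ : ℕ
    ℓ = len (e i)
    inside-i′ : ∀ k {n} → k + n ≤ len (e i′) → FactorsEqual T P (i′ + k) (pos (e i′) + k) n
    inside-i′ k fits = FactorsEqual-window k fits (match i′<m)
    copy-start : ∀ k → pos (e i′) + k ≡ pos (e i) → k + ℓ ≤ len (e i′) → i′ + k ≡ i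
    copy-start k pk fits =
      OccursOnce-unique onceP (FactorsEqual⇒OccursAt copy)
                              (FactorsEqual⇒OccursAt (FactorsEqual-refl (proj₁ (match i<m))))
      where
      copy : FactorsEqual P P i (i′ + k) ℓ
      copy = FactorsEqual-trans (match i<m)
               (FactorsEqual-sym (subst (λ q → FactorsEqual T P (i′ + k) q ℓ) pk (inside-i′ k fits)))
    preceded-by-match : ∀ k → i′ + suc k ≡ i → suc k + ℓ ≤ len (e i′) →
                        ¬ (i ≡ 0 ⊎ ¬ Occurs T (factor P (i ∸ 1) (suc ℓ)))
    preceded-by-match k i′+1+k≡i fits (inj₁ i≡0) = m+1+n≢0 i′ (trans i′+1+k≡i i≡0)
    preceded-by-match k i′+1+k≡i fits (inj₂ ¬extends) = ¬extends (pos (e i′) + k , FactorsEqual⇒OccursAt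
            (subst (λ x → FactorsEqual T P x (pos (e i′) + k) (suc ℓ)) i′+k≡i∸1
              (inside-i′ k (subst (_≤ len (e i′)) (sym (+-suc k ℓ)) fits))))
      where
      i′+k≡i∸1 : i′ + k ≡ i ∸ 1
      i′+k≡i∸1 = cong (_∸ 1) (trans (sym (+-suc i′ k)) i′+1+k≡i)
    copy-inside-i′ : ∀ k → pos (e i′) + k ≡ pos (e i) → k + ℓ ≤ len (e i′) → ⊥
    copy-inside-i′ zero    pk fits = i′≢i (trans (sym (+-identityʳ i′)) (copy-start 0 pk fits))
    copy-inside-i′ (suc k) pk fits = preceded-by-match k (copy-start (suc k) pk fits) fits left-maximal

  covering-match-in-L : ∀ {x j ℓ} → x < length P → x ≤ j → Reaches (j + ℓ) x →
                        (x ≡ 0 ⊎ ¬ Reaches (j + ℓ) (x ∸ 1)) → OccursOnce T (factor P j ℓ) → InL T P e x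
  covering-match-in-L {x} {j} {ℓ} x<m x≤j reach start once =
    x<m ,
    ((proj₁ (match x<m) , pos (e x) , FactorsEqual⇒OccursAt (match x<m)) ,
     leftmost-reaching⇒left-maximal x x<m reach start , right-maximal x<m) ,
    OccursOnce-superfactor (j ∸ x) (offset-fits x≤j reach) (match x<m)
      (subst (λ y → OccursOnce T (factor P y ℓ)) (sym (m+[n∸m]≡n x≤j)) once)

  second-occurrence⇒Nested : ∀ {i j} → 0 < length T → i < length P → OccursOnce T (factor P i (len (e i))) →
                             FactorsEqual P P i j (len (e i)) → j ≢ i →
                             ∃ λ j′ → InL T P e j′ × j′ ≢ i × Nested i j′
  second-occurrence⇒Nested {i} {j} 0<∣T∣ i<m onceT copy j≢i =
    leftmost (run-start (λ x → j + ℓ ≤? x + len (e x)) (+-monoʳ-≤ j (len-maximal j<m copyInT)))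
    where
    ℓ : ℕ
    ℓ = len (e i)
    copyInT : FactorsEqual T P j (pos (e i)) ℓ
    copyInT = FactorsEqual-trans (FactorsEqual-sym copy) (match i<m)
    j<m : j < length P
    j<m = <-≤-trans (m<m+n j (OccursOnce⇒nonempty {P = P} {i} 0<∣T∣ onceT)) (proj₁ (proj₂ copy))
    onceTj : OccursOnce T (factor P j ℓ)
    onceTj = subst (OccursOnce T) (proj₂ (proj₂ copy)) onceT
    leftmost : (∃ λ j′ → j′ ≤ j × Reaches (j + ℓ) j′ × (j′ ≡ 0 ⊎ ¬ Reaches (j + ℓ) (j′ ∸ 1))) →
               ∃ λ j′ → InL T P e j′ × j′ ≢ i × Nested i j′
    leftmost (j′ , j′≤j , reach , start) =
      j′ , covering-match-in-L j′<m j′≤j reach start onceTj , j′≢i , window-within pos-offset fits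
      where
      j′<m : j′ < length P
      j′<m = ≤-<-trans j′≤j j<m
      j′+k≡j : j′ + (j ∸ j′) ≡ j
      j′+k≡j = m+[n∸m]≡n j′≤j
      fits : j ∸ j′ + ℓ ≤ len (e j′)
      fits = offset-fits j′≤j reach
      pos-offset : pos (e j′) + (j ∸ j′) ≡ pos (e i)
      pos-offset = OccursOnce-window-position (j ∸ j′) fits (match j′<m)
        (subst (λ y → OccursOnce T (factor P y ℓ)) (sym j′+k≡j) onceTj)
        (subst (λ y → FactorsEqual T P y (pos (e i)) ℓ) (sym j′+k≡j) copyInT)
      j′≢i : j′ ≢ i
      j′≢i j′≡i = j≢i (≤-antisym (+-cancelʳ-≤ ℓ j i (subst (Reaches (j + ℓ)) j′≡i reach))
                                 (subst (_≤ j) j′≡i j′≤j))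

  ¬Nested⇒OccursOnce-in-P : ∀ {i} → 0 < length T → i < length P → OccursOnce T (factor P i (len (e i))) →
                            (∀ i′ → InL T P e i′ → i′ ≢ i → ¬ Nested i i′) →
                            OccursOnce P (factor P i (len (e i)))
  ¬Nested⇒OccursOnce-in-P {i} 0<∣T∣ i<m onceT ¬nested =
    i , FactorsEqual⇒OccursAt (FactorsEqual-refl (proj₁ (match i<m))) , only-i
    where
    no-nesting : ¬ (∃ λ j′ → InL T P e j′ × j′ ≢ i × Nested i j′)
    no-nesting (j′ , j′∈L , j′≢i , nested) = ¬nested j′ j′∈L j′≢i nested
    only-i : ∀ j → OccursAt P (factor P i (len (e i))) j → j ≡ i
    only-i j occ with j ≟ i
    ... | yes j≡i = j≡i
    ... | no j≢i = ⊥-elim (no-nesting (second-occurrence⇒Nested 0<∣T∣ i<m onceT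
                                         (OccursAt⇒FactorsEqual (proj₁ (match i<m)) occ) j≢i))

theorem1 : (A : Set) (T P : List A) (d : A) → EndsWithUniqueTerminator T d →
    (e : ℕ → Triple) → IsEMS T P e →
    ∀ i → i < length P →
    IsMUM T P i (len (e i))
    ⇔ (InL T P e i
    × (∀ i′ → InL T P e i′ → i′ ≢ i →
    pos (e i) < pos (e i′)
    ⊎ len (e i′) + pos (e i′) < len (e i) + pos (e i)))
theorem1 A T P d terminated e ems i i<m = mk⇔
  (λ { mum@(maximal , onceT , _) →
       (i<m , maximal , onceT) ,
       λ { i′ (i′<m , _) i′≢i → ¬Nested⇒separated (MUM⇒¬Nested i<m i′<m i′≢i mum) } })
  (λ { ((_ , maximal , onceT) , separated) →
       maximal , onceT ,
       ¬Nested⇒OccursOnce-in-P (EndsWithUniqueTerminator⇒nonempty terminated) i<m onceT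
         (λ i′ i′∈L i′≢i → separated⇒¬Nested (separated i′ i′∈L i′≢i)) })
  where open MatchingStatistics ems
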